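{- Let $f\in\mathbb{F}_q[t]$ with $\deg f\ge 1$, and assume that either $q\ge 3$ or $f\neq b(t+c)^2$ for all $b,c\in\mathbb{F}_q$. Then $f$ is irreducible if and only if $S(f)=t^{\deg f}$.
   Context: Let $\mathbb{F}_q$ be a finite field with $q$ elements ($q$ a prime power). Fix an enumeration $\mathbb{F}_q=\{a_0,a_1,\dots,a_{q-1}\}$ with $a_0=0$, $a_1=1$. Every nonzero $f\in\mathbb{F}_q[t]$ of degree $m$ is uniquely written $f=a_{i_0}+a_{i_1}t+\dots+a_{i_m}t^m$ with $0\le i_j\le q-1$, $a_{i_m}\neq 0$. Put $\delta(f)=i_0+i_1q+\dots+i_mq^m$ and $\delta(0)=0$. Order $\mathbb{F}_q[t]$ by: $f>g$ iff $\delta(f)>\delta(g)$. For nonzero $f$, $f!=\prod_{g<f}(f-g)$ (product over all $g\in\mathbb{F}_q[t]$ with $g<f$), and $0!=1$. For nonzero $f$, $S(f)$ is the smallest $g$ (in this order) with $f\mid g!$; $S(0)=0$. -}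

module Defs where

open import Data.Nat using (ℕ; zero; suc; _+_; _*_; _∸_; _<_; _≤_)
open import Data.Nat.DivMod using (_%_; _/_; m%n<n)
open import Data.Fin using (Fin; toℕ; fromℕ<) renaming (zero to fzero; suc to fsuc)
import Data.Fin as Fin
open import Data.List using (List; []; _∷_; map; foldr; length; replicate; _++_)
open import Data.Product using (Σ; ∃; _×_; _,_)
open import Data.Sum using (_⊎_)
open import Relation.Nullary using (¬_; yes; no)
open import Relation.Binary.PropositionalEquality using (_≡_; _≢_)
open import Algebra.Structures using (IsCommutativeRing)

-- A finite field with q = 2 + k elements, whose elements are labelled by
-- Fin q via the fixed enumeration a_i = i, with a_0 = 0 and a_1 = 1.
record FiniteField (k : ℕ) : Set where
  field
    _+F_ _*F_ : Fin (suc (suc k)) → Fin (suc (suc k)) → Fin (suc (suc k))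
    -F_ : Fin (suc (suc k)) → Fin (suc (suc k))
    isCommRing : IsCommutativeRing _≡_ _+F_ _*F_ -F_ fzero (fsuc fzero)
    inverse : ∀ x → x ≢ fzero → ∃ λ y → x *F y ≡ fsuc fzero

module Poly {k : ℕ} (𝔽 : FiniteField k) where
  open FiniteField 𝔽

  q : ℕ
  q = suc (suc k)

  F : Set
  F = Fin q

  0F 1F : F
  0F = fzero
  1F = fsuc fzero

  -- polynomials as coefficient lists a_0 ∷ a_1 ∷ … (lowest degree first)
  Pol : Set
  Pol = List F

  norm : Pol → Pol
  norm [] = []
  norm (a ∷ as) with norm as
  ... | b ∷ bs = a ∷ b ∷ bs
  ... | [] with a Fin.≟ 0F
  ...    | yes _ = []
  ...    | no _ = a ∷ []

  Normal : Pol → Set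
  Normal f = norm f ≡ f

  addR : Pol → Pol → Pol
  addR [] bs = bs
  addR (a ∷ as) [] = a ∷ as
  addR (a ∷ as) (b ∷ bs) = (a +F b) ∷ addR as bs

  mulR : Pol → Pol → Pol
  mulR [] bs = []
  mulR (a ∷ as) bs = addR (map (a *F_) bs) (0F ∷ mulR as bs)

  _⊕_ _⊗_ _⊖_ : Pol → Pol → Pol
  f ⊕ g = norm (addR f g)
  f ⊗ g = norm (mulR f g)
  f ⊖ g = norm (addR f (map -F_ g))

  one : Pol
  one = 1F ∷ []

  tpow : ℕ → Pol
  tpow d = replicate d 0F ++ (1F ∷ [])

  -- degree (for nonzero normalised f)
  deg : Pol → ℕ
  deg f = length f ∸ 1

  δ : Pol → ℕ
  δ = foldr (λ a acc → toℕ a + q * acc) 0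

  -- base-q digits with fuel; polyOf m is the unique normalised g with δ g = m
  digits : ℕ → ℕ → Pol
  digits zero m = []
  digits (suc fuel) m = fromℕ< (m%n<n m q) ∷ digits fuel (m / q)

  polyOf : ℕ → Pol
  polyOf m = norm (digits m m)

  prodR : List Pol → Pol
  prodR = foldr _⊗_ one

  upTo : ℕ → List ℕ
  upTo zero = []
  upTo (suc n) = n ∷ upTo n

  -- f! = ∏_{g < f} (f - g); the g < f are exactly polyOf m for m < δ f
  -- (empty product = 1 when f = 0)
  fact : Pol → Pol
  fact f = prodR (map (λ m → f ⊖ polyOf m) (upTo (δ f)))

  _∣P_ : Pol → Pol → Set
  f ∣P g = ∃ λ h → f ⊗ h ≡ g

  IsUnit : Pol → Set
  IsUnit g = ∃ λ h → g ⊗ h ≡ one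

  Irreducible : Pol → Set
  Irreducible f = (f ≢ []) × (¬ IsUnit f)
                × (∀ g h → g ⊗ h ≡ f → IsUnit g ⊎ IsUnit h)

  -- "S(f) = g": g is the smallest polynomial (in the δ-order) with f ∣ g!
  IsS : Pol → Pol → Set
  IsS f g = (f ∣P fact g) × (∀ h → Normal h → δ h < δ g → ¬ (f ∣P fact h))

{-# OPTIONS --safe #-}
-- Order F_q[t] by δ, the base-q number spelled by the coefficients. The polynomials below t^d are
-- those of degree < d, so the factors t^d - g of (t^d)! are all monic polynomials of degree d, and
-- for h below t^d every factor of h! is nonzero of degree < d. If f is irreducible of degree d, its
-- monic associate is a factor of (t^d)!, while Euclid's lemma (proved by long division) shows that
-- f divides no product of nonzero polynomials of degree < d; hence S(f) = t^d.
-- Conversely, the factors of H!, for H the largest polynomial of degree < d, are all nonzero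
-- polynomials of degree < d, so H! is divisible by the product of any two distinct ones. A proper
-- factorisation f = gh yields two distinct ones whose product f divides: g and h if g ≠ h, and
-- otherwise g and 2g (q ≥ 3) or g and tg (deg g ≥ 2); the one remaining case, q = 2 and
-- f = (t + c)², is excluded by hypothesis.
-- Then f divides H! although H is below t^d, so S(f) ≠ t^d.
module Submission where

open import Algebra.Bundles using (CommutativeMonoid; CommutativeRing; Ring)
import Algebra.Consequences.Setoid as SetoidConsequences
import Algebra.Definitions as Definitions
import Algebra.Properties.CommutativeSemigroup as CommutativeSemigroupProperties
import Algebra.Properties.Ring as RingProperties
open import Data.Empty using (⊥-elim)
open import Data.Fin using (toℕ; fromℕ<)
import Data.Fin as Fin
open import Data.Fin.Properties using (toℕ-injective; toℕ<n; toℕ-fromℕ<)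
open import Data.List using (List; []; _∷_; length; map; foldr; applyDownFrom)
open import Data.List.Properties using (≡-dec)
open import Data.Nat using (ℕ; zero; suc; _≤_; _<_; z≤n; s≤s; _^_; _∸_; _≟_; >-nonZero)
import Data.Nat as ℕ
open import Data.Nat.DivMod
  using (_%_; _/_; m%n<n; m<n*o⇒m/o<n; m≡m%n+[m/n]*n; [m+kn]%n≡m%n; m<n⇒m%n≡m)
open import Data.Nat.Induction using (<-wellFounded)
import Data.Nat.Properties as ℕP
open import Data.Nat.Properties
  using (0≢1+n; 1+n≢n; m<m+n; m≤m+n; m≤n+m; m<n⇒m<1+n; m≤n⇒m<n∨m≡n; m+n≡0⇒m≡0;
         suc-injective; _≤?_; ≤-pred; ≤∧≢⇒<; ≤-trans; ≤-refl; ≤-reflexive; ≤-antisym; ≰⇒>;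
         ≤-<-connex; <-irrefl; <-trans; <-≤-trans; <⇒≢; <⇒≱; ∸-monoʳ-<; ∸-monoˡ-≤; +-monoˡ-<;
         *-monoʳ-≤; ^-monoʳ-≤; m<m*n; m^n>0; n≢0⇒n>0;
         *-suc; *-zeroʳ; *-cancelˡ-≡; +-cancelˡ-≡; module ≤-Reasoning)
open import Data.Product using (_×_; _,_; proj₁; proj₂; ∃)
open import Data.Sum using (_⊎_; inj₁; inj₂; [_,_]′)
open import Defs
open import Function using (case_of_; _∘_)
open import Function.Bundles using (_⇔_; mk⇔)
open import Induction.WellFounded using (Acc; acc)
open import Level using (0ℓ)
open import Relation.Binary.Bundles using (Setoid)
open import Relation.Binary.PropositionalEquality
  using (_≡_; _≢_; refl; sym; trans; cong; cong₂; subst; subst₂; module ≡-Reasoning)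
import Relation.Binary.Reasoning.Setoid as SetoidReasoning
open import Relation.Binary.Structures using (IsEquivalence)
open import Relation.Nullary using (¬_; yes; no; contradiction)

module ProductOverRange {c ℓ} (M : CommutativeMonoid c ℓ) where
  open CommutativeMonoid M using (Carrier; _∙_; ε; comm; commutativeSemigroup)
  open import Algebra.Properties.CommutativeSemigroup.Divisibility commutativeSemigroup

  ∏ : List Carrier → Carrier
  ∏ = foldr _∙_ ε

  private
    <-pred-≢ : ∀ {m N} → m < suc N → m ≢ N → m < N
    <-pred-≢ m<1+N m≢N = ≤∧≢⇒< (≤-pred m<1+N) m≢N

  factor∣∏ : ∀ G {m N} → m < N → G m ∣ ∏ (applyDownFrom G N)
  factor∣∏ G {m} {suc N} m<1+N with m ≟ N
  ... | yes refl = x∣xy (G N) _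
  ... | no m≢N = x∣ʳy⇒x∣ʳzy (G N) (factor∣∏ G (<-pred-≢ m<1+N m≢N))

  distinctFactors∣∏ : ∀ G {i j N} → i ≢ j → i < N → j < N →
                      G i ∙ G j ∣ ∏ (applyDownFrom G N)
  distinctFactors∣∏ G {i} {j} {suc N} i≢j i<1+N j<1+N with i ≟ N | j ≟ N
  ... | yes refl | yes refl = contradiction refl i≢j
  ... | yes refl | no j≢N = x∣y⇒zx∣zy (G N) (factor∣∏ G (<-pred-≢ j<1+N j≢N))
  ... | no i≢N | yes refl =
    ∣ʳ-respˡ-≈ (comm (G N) (G i)) (x∣y⇒zx∣zy (G N) (factor∣∏ G (<-pred-≢ i<1+N i≢N)))
  ... | no i≢N | no j≢N =
    x∣ʳy⇒x∣ʳzy (G N) (distinctFactors∣∏ G i≢j (<-pred-≢ i<1+N i≢N) (<-pred-≢ j<1+N j≢N))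

module RingDivisibility {c ℓ} (R : Ring c ℓ) where
  open Ring R using (_-_; +-cong; -‿cong; *-rawMagma) renaming (trans to ≈-trans)
  open import Algebra.Properties.Ring R using ([y-z]x≈yx-zx)
  open import Algebra.Definitions.RawMagma *-rawMagma using (_∣_; _,_)

  ∣x∣y⇒∣x-y : ∀ {d x y} → d ∣ x → d ∣ y → d ∣ x - y
  ∣x∣y⇒∣x-y {d} (p , pd≈x) (q , qd≈y) =
    p - q , ≈-trans ([y-z]x≈yx-zx d p q) (+-cong pd≈x (-‿cong qd≈y))

module PolynomialsOver {k : ℕ} (𝔽 : FiniteField k) where
  open FiniteField 𝔽
  open Poly 𝔽

  F-commutativeRing : CommutativeRing 0ℓ 0ℓ
  F-commutativeRing = record
    { Carrier = F ; _≈_ = _≡_ ; _+_ = _+F_ ; _*_ = _*F_ ; -_ = -F_ ; 0# = 0F ; 1# = 1F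
    ; isCommutativeRing = isCommRing }

  open CommutativeRing F-commutativeRing
    using (_+_; _*_; -_; +-comm; +-assoc; +-identityˡ; +-identityʳ; -‿inverseʳ;
           *-comm; *-assoc; *-identityˡ; *-identityʳ; distribˡ; distribʳ; zeroˡ; zeroʳ;
           ring; +-commutativeSemigroup)
  open RingProperties ring using (-0#≈0#)
  open CommutativeSemigroupProperties +-commutativeSemigroup using (interchange)

  inv : (c : F) → c ≢ 0F → F
  inv c c≢0 = proj₁ (inverse c c≢0)

  inv-inverseʳ : ∀ c (c≢0 : c ≢ 0F) → c * inv c c≢0 ≡ 1F
  inv-inverseʳ c c≢0 = proj₂ (inverse c c≢0)

  inv-inverseˡ : ∀ c (c≢0 : c ≢ 0F) → inv c c≢0 * c ≡ 1F
  inv-inverseˡ c c≢0 = trans (*-comm (inv c c≢0) c) (inv-inverseʳ c c≢0)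

  inv-nonzero : ∀ c (c≢0 : c ≢ 0F) → inv c c≢0 ≢ 0F
  inv-nonzero c c≢0 c⁻¹≡0 with () ←
    trans (sym (inv-inverseʳ c c≢0)) (trans (cong (c *_) c⁻¹≡0) (zeroʳ c))

  *-nonzero : ∀ {a b} → a ≢ 0F → b ≢ 0F → a * b ≢ 0F
  *-nonzero {a} {b} a≢0 b≢0 ab≡0 = b≢0 (begin
    b                      ≡⟨ *-identityˡ b ⟨
    1F * b                 ≡⟨ cong (_* b) (inv-inverseˡ a a≢0) ⟨
    (inv a a≢0 * a) * b    ≡⟨ *-assoc (inv a a≢0) a b ⟩
    inv a a≢0 * (a * b)    ≡⟨ cong (inv a a≢0 *_) ab≡0 ⟩
    inv a a≢0 * 0F         ≡⟨ zeroʳ (inv a a≢0) ⟩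
    0F                     ∎)
    where open ≡-Reasoning

  *≡⇒≡1 : ∀ {a l} → l ≢ 0F → a * l ≡ l → a ≡ 1F
  *≡⇒≡1 {a} {l} l≢0 al≡l = begin
    a                      ≡⟨ *-identityʳ a ⟨
    a * 1F                 ≡⟨ cong (a *_) (inv-inverseʳ l l≢0) ⟨
    a * (l * inv l l≢0)    ≡⟨ *-assoc a l (inv l l≢0) ⟨
    (a * l) * inv l l≢0    ≡⟨ cong (_* inv l l≢0) al≡l ⟩
    l * inv l l≢0          ≡⟨ inv-inverseʳ l l≢0 ⟩
    1F                     ∎
    where open ≡-Reasoning

  q≡2⇒nonzero≡1 : ¬ (3 ≤ q) → ∀ (e : F) → e ≢ 0F → e ≡ 1F
  q≡2⇒nonzero≡1 3≰q e e≢0 = toℕ-injective (digit≡1 (toℕ e) (toℕ<n e) (e≢0 ∘ toℕ-injective))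
    where
    digit≡1 : ∀ n → n < q → n ≢ 0 → n ≡ 1
    digit≡1 zero _ n≢0 = contradiction refl n≢0
    digit≡1 (suc zero) _ _ = refl
    digit≡1 (suc (suc n)) n<q _ = contradiction (≤-trans (s≤s (s≤s (s≤s z≤n))) n<q) 3≰q

  coeff : Pol → ℕ → F
  coeff [] n = 0F
  coeff (a ∷ as) zero = a
  coeff (a ∷ as) (suc n) = coeff as n

  -- Lists differing by trailing zeros denote the same polynomial; ring laws hold up to this equality.
  infix 4 _≈_
  record _≈_ (p r : Pol) : Set where
    constructor mk≈
    field coeff-≡ : ∀ n → coeff p n ≡ coeff r n
  open _≈_ public

  ≈-isEquivalence : IsEquivalence _≈_
  ≈-isEquivalence = record
    { refl = mk≈ λ n → refl
    ; sym = λ e → mk≈ λ n → sym (coeff-≡ e n)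
    ; trans = λ e e′ → mk≈ λ n → trans (coeff-≡ e n) (coeff-≡ e′ n) }

  ≈-setoid : Setoid 0ℓ 0ℓ
  ≈-setoid = record { isEquivalence = ≈-isEquivalence }

  open Setoid ≈-setoid using () renaming (refl to ≈-refl; sym to ≈-sym; trans to ≈-trans)

  ∷-cong : ∀ {a b as bs} → a ≡ b → as ≈ bs → (a ∷ as) ≈ (b ∷ bs)
  ∷-cong a≡b e = mk≈ λ { zero → a≡b ; (suc n) → coeff-≡ e n }

  []≈0∷[] : [] ≈ (0F ∷ [])
  []≈0∷[] = mk≈ λ { zero → refl ; (suc n) → refl }

  ∷-injective : ∀ {a b as bs} → (a ∷ as) ≈ (b ∷ bs) → a ≡ b × as ≈ bs
  ∷-injective e = coeff-≡ e 0 , mk≈ λ n → coeff-≡ e (suc n)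

  ∷≈[] : ∀ {a as} → (a ∷ as) ≈ [] → a ≡ 0F × as ≈ []
  ∷≈[] e = coeff-≡ e 0 , mk≈ λ n → coeff-≡ e (suc n)

  scale : F → Pol → Pol
  scale c = map (c *_)

  neg : Pol → Pol
  neg = map -_

  shift : Pol → Pol
  shift p = 0F ∷ p

  coeff-addR : ∀ p r n → coeff (addR p r) n ≡ coeff p n + coeff r n
  coeff-addR [] r n = sym (+-identityˡ _)
  coeff-addR (a ∷ as) [] zero = sym (+-identityʳ a)
  coeff-addR (a ∷ as) [] (suc n) = sym (+-identityʳ _)
  coeff-addR (a ∷ as) (b ∷ bs) zero = refl
  coeff-addR (a ∷ as) (b ∷ bs) (suc n) = coeff-addR as bs n

  coeff-map : ∀ g → g 0F ≡ 0F → ∀ p n → coeff (map g p) n ≡ g (coeff p n)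
  coeff-map g g0≡0 [] n = sym g0≡0
  coeff-map g g0≡0 (a ∷ as) zero = refl
  coeff-map g g0≡0 (a ∷ as) (suc n) = coeff-map g g0≡0 as n

  coeff-scale : ∀ c p n → coeff (scale c p) n ≡ c * coeff p n
  coeff-scale c = coeff-map (c *_) (zeroʳ c)

  coeff-neg : ∀ p n → coeff (neg p) n ≡ - coeff p n
  coeff-neg = coeff-map -_ -0#≈0#

  addR-cong : ∀ {p p′ r r′} → p ≈ p′ → r ≈ r′ → addR p r ≈ addR p′ r′
  addR-cong {p} {p′} {r} {r′} e e′ = mk≈ λ n → begin
    coeff (addR p r) n      ≡⟨ coeff-addR p r n ⟩
    coeff p n + coeff r n   ≡⟨ cong₂ _+_ (coeff-≡ e n) (coeff-≡ e′ n) ⟩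
    coeff p′ n + coeff r′ n ≡⟨ coeff-addR p′ r′ n ⟨
    coeff (addR p′ r′) n    ∎
    where open ≡-Reasoning

  addR-comm : ∀ p r → addR p r ≈ addR r p
  addR-comm p r = mk≈ λ n →
    trans (coeff-addR p r n) (trans (+-comm _ _) (sym (coeff-addR r p n)))

  addR-assoc : ∀ p r s → addR (addR p r) s ≈ addR p (addR r s)
  addR-assoc p r s = mk≈ λ n → begin
    coeff (addR (addR p r) s) n           ≡⟨ coeff-addR (addR p r) s n ⟩
    coeff (addR p r) n + coeff s n        ≡⟨ cong (_+ coeff s n) (coeff-addR p r n) ⟩
    (coeff p n + coeff r n) + coeff s n   ≡⟨ +-assoc _ _ _ ⟩
    coeff p n + (coeff r n + coeff s n)   ≡⟨ cong (coeff p n +_) (coeff-addR r s n) ⟨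
    coeff p n + coeff (addR r s) n        ≡⟨ coeff-addR p (addR r s) n ⟨
    coeff (addR p (addR r s)) n           ∎
    where open ≡-Reasoning

  addR-interchange : ∀ w x y z → addR (addR w x) (addR y z) ≈ addR (addR w y) (addR x z)
  addR-interchange w x y z = mk≈ λ n → begin
    coeff (addR (addR w x) (addR y z)) n
      ≡⟨ trans (coeff-addR (addR w x) (addR y z) n)
               (cong₂ _+_ (coeff-addR w x n) (coeff-addR y z n)) ⟩
    (coeff w n + coeff x n) + (coeff y n + coeff z n) ≡⟨ interchange _ _ _ _ ⟩
    (coeff w n + coeff y n) + (coeff x n + coeff z n)
      ≡⟨ trans (coeff-addR (addR w y) (addR x z) n)
               (cong₂ _+_ (coeff-addR w y n) (coeff-addR x z n)) ⟨
    coeff (addR (addR w y) (addR x z)) n ∎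
    where open ≡-Reasoning

  addR-identityˡ : ∀ {z} p → z ≈ [] → addR z p ≈ p
  addR-identityˡ {z} p z≈0 = mk≈ λ n →
    trans (coeff-addR z p n) (trans (cong (_+ coeff p n) (coeff-≡ z≈0 n)) (+-identityˡ _))

  addR-identityʳ : ∀ {z} p → z ≈ [] → addR p z ≈ p
  addR-identityʳ p z≈0 = ≈-trans (addR-comm p _) (addR-identityˡ p z≈0)

  addR-inverseʳ : ∀ p → addR p (neg p) ≈ []
  addR-inverseʳ p = mk≈ λ n → trans (coeff-addR p (neg p) n)
    (trans (cong (coeff p n +_) (coeff-neg p n)) (-‿inverseʳ _))

  neg-cong : ∀ {p r} → p ≈ r → neg p ≈ neg r
  neg-cong {p} {r} e = mk≈ λ n →
    trans (coeff-neg p n) (trans (cong -_ (coeff-≡ e n)) (sym (coeff-neg r n)))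

  scale-cong : ∀ c {p r} → p ≈ r → scale c p ≈ scale c r
  scale-cong c {p} {r} e = mk≈ λ n →
    trans (coeff-scale c p n) (trans (cong (c *_) (coeff-≡ e n)) (sym (coeff-scale c r n)))

  scale-distribˡ : ∀ c p r → scale c (addR p r) ≈ addR (scale c p) (scale c r)
  scale-distribˡ c p r = mk≈ λ n → begin
    coeff (scale c (addR p r)) n            ≡⟨ coeff-scale c (addR p r) n ⟩
    c * coeff (addR p r) n                  ≡⟨ cong (c *_) (coeff-addR p r n) ⟩
    c * (coeff p n + coeff r n)             ≡⟨ distribˡ c _ _ ⟩
    c * coeff p n + c * coeff r n           ≡⟨ cong₂ _+_ (coeff-scale c p n) (coeff-scale c r n) ⟨
    coeff (scale c p) n + coeff (scale c r) n ≡⟨ coeff-addR (scale c p) (scale c r) n ⟨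
    coeff (addR (scale c p) (scale c r)) n  ∎
    where open ≡-Reasoning

  scale-distribʳ : ∀ a b p → scale (a + b) p ≈ addR (scale a p) (scale b p)
  scale-distribʳ a b p = mk≈ λ n → begin
    coeff (scale (a + b) p) n               ≡⟨ coeff-scale (a + b) p n ⟩
    (a + b) * coeff p n                     ≡⟨ distribʳ _ a b ⟩
    a * coeff p n + b * coeff p n           ≡⟨ cong₂ _+_ (coeff-scale a p n) (coeff-scale b p n) ⟨
    coeff (scale a p) n + coeff (scale b p) n ≡⟨ coeff-addR (scale a p) (scale b p) n ⟨
    coeff (addR (scale a p) (scale b p)) n  ∎
    where open ≡-Reasoning

  scale-scale : ∀ a b p → scale a (scale b p) ≈ scale (a * b) p
  scale-scale a b p = mk≈ λ n → trans (coeff-scale a (scale b p) n)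
    (trans (cong (a *_) (coeff-scale b p n)) (trans (sym (*-assoc a b _)) (sym (coeff-scale (a * b) p n))))

  scale-identity : ∀ p → scale 1F p ≈ p
  scale-identity p = mk≈ λ n → trans (coeff-scale 1F p n) (*-identityˡ _)

  scale-zero : ∀ {c} p → c ≡ 0F → scale c p ≈ []
  scale-zero {c} p c≡0 = mk≈ λ n →
    trans (coeff-scale c p n) (trans (cong (_* coeff p n) c≡0) (zeroˡ _))

  shift-addR : ∀ p r → shift (addR p r) ≈ addR (shift p) (shift r)
  shift-addR p r = ∷-cong (sym (+-identityʳ 0F)) ≈-refl

  scale-shift : ∀ c p → scale c (shift p) ≈ shift (scale c p)
  scale-shift c p = ∷-cong (zeroʳ c) ≈-refl

  shift-[] : ∀ {z} → z ≈ [] → shift z ≈ []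
  shift-[] z≈0 = mk≈ λ { zero → refl ; (suc n) → coeff-≡ z≈0 n }

  ∷≈const+shift : ∀ a p → (a ∷ p) ≈ addR (a ∷ []) (shift p)
  ∷≈const+shift a p = ∷-cong (sym (+-identityʳ a)) ≈-refl

  mulR-zeroˡ : ∀ {z} r → z ≈ [] → mulR z r ≈ []
  mulR-zeroˡ {[]} r _ = ≈-refl
  mulR-zeroˡ {a ∷ as} r z≈0 =
    ≈-trans (addR-identityˡ _ (scale-zero r (proj₁ (∷≈[] z≈0))))
            (shift-[] (mulR-zeroˡ r (proj₂ (∷≈[] z≈0))))

  mulR-zeroʳ : ∀ p → mulR p [] ≈ []
  mulR-zeroʳ [] = ≈-refl
  mulR-zeroʳ (a ∷ as) = shift-[] (mulR-zeroʳ as)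

  mulR-congˡ : ∀ {p p′} r → p ≈ p′ → mulR p r ≈ mulR p′ r
  mulR-congˡ {[]} r e = ≈-sym (mulR-zeroˡ r (≈-sym e))
  mulR-congˡ {a ∷ as} {[]} r e = mulR-zeroˡ r e
  mulR-congˡ {a ∷ as} {b ∷ bs} r e =
    addR-cong (scale-cong′ (proj₁ (∷-injective e)))
              (∷-cong refl (mulR-congˡ r (proj₂ (∷-injective e))))
    where
    scale-cong′ : a ≡ b → scale a r ≈ scale b r
    scale-cong′ refl = ≈-refl

  mulR-congʳ : ∀ p {r r′} → r ≈ r′ → mulR p r ≈ mulR p r′
  mulR-congʳ [] e = ≈-refl
  mulR-congʳ (a ∷ as) e = addR-cong (scale-cong a e) (∷-cong refl (mulR-congʳ as e))

  mulR-cong : ∀ {p p′ r r′} → p ≈ p′ → r ≈ r′ → mulR p r ≈ mulR p′ r′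
  mulR-cong {p′ = p′} {r = r} e e′ = ≈-trans (mulR-congˡ r e) (mulR-congʳ p′ e′)

  mulR-distribʳ : ∀ p p′ r → mulR (addR p p′) r ≈ addR (mulR p r) (mulR p′ r)
  mulR-distribʳ [] p′ r = ≈-refl
  mulR-distribʳ (a ∷ as) [] r = ≈-sym (addR-identityʳ (mulR (a ∷ as) r) ≈-refl)
  mulR-distribʳ (a ∷ as) (b ∷ bs) r = begin
    addR (scale (a + b) r) (shift (mulR (addR as bs) r))
      ≈⟨ addR-cong (scale-distribʳ a b r) (∷-cong refl (mulR-distribʳ as bs r)) ⟩
    addR (addR (scale a r) (scale b r)) (shift (addR (mulR as r) (mulR bs r)))
      ≈⟨ addR-cong ≈-refl (shift-addR (mulR as r) (mulR bs r)) ⟩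
    addR (addR (scale a r) (scale b r)) (addR (shift (mulR as r)) (shift (mulR bs r)))
      ≈⟨ addR-interchange (scale a r) (scale b r) (shift (mulR as r)) (shift (mulR bs r)) ⟩
    addR (mulR (a ∷ as) r) (mulR (b ∷ bs) r) ∎
    where open SetoidReasoning ≈-setoid

  mulR-distribˡ : ∀ p r r′ → mulR p (addR r r′) ≈ addR (mulR p r) (mulR p r′)
  mulR-distribˡ [] r r′ = ≈-refl
  mulR-distribˡ (a ∷ as) r r′ = begin
    addR (scale a (addR r r′)) (shift (mulR as (addR r r′)))
      ≈⟨ addR-cong (scale-distribˡ a r r′) (∷-cong refl (mulR-distribˡ as r r′)) ⟩
    addR (addR (scale a r) (scale a r′)) (shift (addR (mulR as r) (mulR as r′)))
      ≈⟨ addR-cong ≈-refl (shift-addR (mulR as r) (mulR as r′)) ⟩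
    addR (addR (scale a r) (scale a r′)) (addR (shift (mulR as r)) (shift (mulR as r′)))
      ≈⟨ addR-interchange (scale a r) (scale a r′) (shift (mulR as r)) (shift (mulR as r′)) ⟩
    addR (mulR (a ∷ as) r) (mulR (a ∷ as) r′) ∎
    where open SetoidReasoning ≈-setoid

  mulR-scaleˡ : ∀ c p r → mulR (scale c p) r ≈ scale c (mulR p r)
  mulR-scaleˡ c [] r = ≈-refl
  mulR-scaleˡ c (b ∷ bs) r = begin
    addR (scale (c * b) r) (shift (mulR (scale c bs) r))
      ≈⟨ addR-cong (≈-sym (scale-scale c b r)) (∷-cong refl (mulR-scaleˡ c bs r)) ⟩
    addR (scale c (scale b r)) (shift (scale c (mulR bs r)))
      ≈⟨ addR-cong ≈-refl (≈-sym (scale-shift c (mulR bs r))) ⟩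
    addR (scale c (scale b r)) (scale c (shift (mulR bs r)))
      ≈⟨ scale-distribˡ c (scale b r) (shift (mulR bs r)) ⟨
    scale c (mulR (b ∷ bs) r) ∎
    where open SetoidReasoning ≈-setoid

  mulR-shiftˡ : ∀ p r → mulR (shift p) r ≈ shift (mulR p r)
  mulR-shiftˡ p r = addR-identityˡ _ (scale-zero r refl)

  mulR-shiftʳ : ∀ p r → mulR p (shift r) ≈ shift (mulR p r)
  mulR-shiftʳ [] r = ≈-sym (shift-[] ≈-refl)
  mulR-shiftʳ (b ∷ bs) r = ≈-trans (addR-cong (scale-shift b r) (∷-cong refl (mulR-shiftʳ bs r)))
    (≈-sym (shift-addR (scale b r) (shift (mulR bs r))))

  mulR-constˡ : ∀ c p → mulR (c ∷ []) p ≈ scale c p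
  mulR-constˡ c p = addR-identityʳ _ (shift-[] ≈-refl)

  mulR-constʳ : ∀ p c → mulR p (c ∷ []) ≈ scale c p
  mulR-constʳ [] c = ≈-refl
  mulR-constʳ (b ∷ bs) c =
    ≈-trans (≈-sym (∷≈const+shift (b * c) (mulR bs (c ∷ []))))
            (∷-cong (*-comm b c) (mulR-constʳ bs c))

  mulR-comm : ∀ p r → mulR p r ≈ mulR r p
  mulR-comm [] r = ≈-sym (mulR-zeroʳ r)
  mulR-comm (a ∷ as) r = begin
    addR (scale a r) (shift (mulR as r))
      ≈⟨ addR-cong (≈-sym (mulR-constʳ r a)) (∷-cong refl (mulR-comm as r)) ⟩
    addR (mulR r (a ∷ [])) (shift (mulR r as))  ≈⟨ addR-cong ≈-refl (mulR-shiftʳ r as) ⟨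
    addR (mulR r (a ∷ [])) (mulR r (shift as))  ≈⟨ mulR-distribˡ r (a ∷ []) (shift as) ⟨
    mulR r (addR (a ∷ []) (shift as))           ≈⟨ mulR-congʳ r (∷≈const+shift a as) ⟨
    mulR r (a ∷ as)                             ∎
    where open SetoidReasoning ≈-setoid

  mulR-assoc : ∀ p r s → mulR (mulR p r) s ≈ mulR p (mulR r s)
  mulR-assoc [] r s = ≈-refl
  mulR-assoc (a ∷ as) r s = begin
    mulR (addR (scale a r) (shift (mulR as r))) s
      ≈⟨ mulR-distribʳ (scale a r) (shift (mulR as r)) s ⟩
    addR (mulR (scale a r) s) (mulR (shift (mulR as r)) s)
      ≈⟨ addR-cong (mulR-scaleˡ a r s) (mulR-shiftˡ (mulR as r) s) ⟩
    addR (scale a (mulR r s)) (shift (mulR (mulR as r) s))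
      ≈⟨ addR-cong ≈-refl (∷-cong refl (mulR-assoc as r s)) ⟩
    mulR (a ∷ as) (mulR r s) ∎
    where open SetoidReasoning ≈-setoid

  mulR-identityˡ : ∀ p → mulR one p ≈ p
  mulR-identityˡ p = ≈-trans (mulR-constˡ 1F p) (scale-identity p)

  normCons : F → Pol → Pol
  normCons a (b ∷ bs) = a ∷ b ∷ bs
  normCons a [] with a Fin.≟ 0F
  ... | yes _ = []
  ... | no _ = a ∷ []

  norm-∷ : ∀ a as → norm (a ∷ as) ≡ normCons a (norm as)
  norm-∷ a as with norm as
  ... | b ∷ bs = refl
  ... | [] with a Fin.≟ 0F
  ...    | yes _ = refl
  ...    | no _ = refl

  normCons-≈ : ∀ a {X as} → X ≈ as → normCons a X ≈ (a ∷ as)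
  normCons-≈ a {b ∷ bs} e = ∷-cong refl e
  normCons-≈ a {[]} e with a Fin.≟ 0F
  ... | yes a≡0 = mk≈ λ { zero → sym a≡0 ; (suc n) → coeff-≡ e n }
  ... | no _ = ∷-cong refl e

  norm-≈ : ∀ p → norm p ≈ p
  norm-≈ [] = ≈-refl
  norm-≈ (a ∷ as) rewrite norm-∷ a as = normCons-≈ a (norm-≈ as)

  norm-[] : ∀ {p} → p ≈ [] → norm p ≡ []
  norm-[] {[]} e = refl
  norm-[] {a ∷ as} e rewrite norm-∷ a as | norm-[] (proj₂ (∷≈[] e)) with a Fin.≟ 0F
  ... | yes _ = refl
  ... | no a≢0 = contradiction (proj₁ (∷≈[] e)) a≢0

  norm-resp : ∀ {p r} → p ≈ r → norm p ≡ norm r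
  norm-resp {[]} {r} e = sym (norm-[] (≈-sym e))
  norm-resp {a ∷ as} {[]} e = norm-[] e
  norm-resp {a ∷ as} {b ∷ bs} e rewrite norm-∷ a as | norm-∷ b bs =
    cong₂ normCons (proj₁ (∷-injective e)) (norm-resp (proj₂ (∷-injective e)))

  norm-normal : ∀ p → Normal (norm p)
  norm-normal p = norm-resp (norm-≈ p)

  normal-≈⇒≡ : ∀ {p r} → Normal p → Normal r → p ≈ r → p ≡ r
  normal-≈⇒≡ np nr e = trans (sym np) (trans (norm-resp e) nr)

  -- The ring of polynomials

  ⊕≈addR : ∀ p r → p ⊕ r ≈ addR p r
  ⊕≈addR p r = norm-≈ (addR p r)

  ⊗≈mulR : ∀ p r → p ⊗ r ≈ mulR p r
  ⊗≈mulR p r = norm-≈ (mulR p r)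

  ⊕-via-addR : ∀ p r p′ r′ → addR p r ≈ addR p′ r′ → p ⊕ r ≈ p′ ⊕ r′
  ⊕-via-addR p r p′ r′ e = ≈-trans (⊕≈addR p r) (≈-trans e (≈-sym (⊕≈addR p′ r′)))

  ⊗-via-mulR : ∀ p r p′ r′ → mulR p r ≈ mulR p′ r′ → p ⊗ r ≈ p′ ⊗ r′
  ⊗-via-mulR p r p′ r′ e = ≈-trans (⊗≈mulR p r) (≈-trans e (≈-sym (⊗≈mulR p′ r′)))

  ⊕-assoc : ∀ p r s → (p ⊕ r) ⊕ s ≈ p ⊕ (r ⊕ s)
  ⊕-assoc p r s = ⊕-via-addR (p ⊕ r) s p (r ⊕ s) (begin
    addR (p ⊕ r) s          ≈⟨ addR-cong (⊕≈addR p r) ≈-refl ⟩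
    addR (addR p r) s       ≈⟨ addR-assoc p r s ⟩
    addR p (addR r s)       ≈⟨ addR-cong ≈-refl (⊕≈addR r s) ⟨
    addR p (r ⊕ s)          ∎)
    where open SetoidReasoning ≈-setoid

  ⊗-assoc : ∀ p r s → (p ⊗ r) ⊗ s ≈ p ⊗ (r ⊗ s)
  ⊗-assoc p r s = ⊗-via-mulR (p ⊗ r) s p (r ⊗ s) (begin
    mulR (p ⊗ r) s          ≈⟨ mulR-congˡ s (⊗≈mulR p r) ⟩
    mulR (mulR p r) s       ≈⟨ mulR-assoc p r s ⟩
    mulR p (mulR r s)       ≈⟨ mulR-congʳ p (⊗≈mulR r s) ⟨
    mulR p (r ⊗ s)          ∎)
    where open SetoidReasoning ≈-setoid

  ⊗-distribʳ : ∀ s p r → (p ⊕ r) ⊗ s ≈ (p ⊗ s) ⊕ (r ⊗ s)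
  ⊗-distribʳ s p r = ≈-trans (⊗≈mulR (p ⊕ r) s) (≈-trans (begin
    mulR (p ⊕ r) s              ≈⟨ mulR-congˡ s (⊕≈addR p r) ⟩
    mulR (addR p r) s           ≈⟨ mulR-distribʳ p r s ⟩
    addR (mulR p s) (mulR r s)  ≈⟨ addR-cong (⊗≈mulR p s) (⊗≈mulR r s) ⟨
    addR (p ⊗ s) (r ⊗ s)        ∎) (≈-sym (⊕≈addR (p ⊗ s) (r ⊗ s))))
    where open SetoidReasoning ≈-setoid

  ⊕-cong : ∀ {p p′ r r′} → p ≈ p′ → r ≈ r′ → p ⊕ r ≈ p′ ⊕ r′
  ⊕-cong {p} {p′} {r} {r′} e e′ = ⊕-via-addR p r p′ r′ (addR-cong e e′)

  ⊗-cong : ∀ {p p′ r r′} → p ≈ p′ → r ≈ r′ → p ⊗ r ≈ p′ ⊗ r′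
  ⊗-cong {p} {p′} {r} {r′} e e′ = ⊗-via-mulR p r p′ r′ (mulR-cong e e′)

  ⊕-comm : ∀ p r → p ⊕ r ≈ r ⊕ p
  ⊕-comm p r = ⊕-via-addR p r r p (addR-comm p r)

  ⊗-comm : ∀ p r → p ⊗ r ≈ r ⊗ p
  ⊗-comm p r = ⊗-via-mulR p r r p (mulR-comm p r)

  open Definitions _≈_ using (Identity; Inverse)

  ⊕-identity : Identity [] _⊕_
  ⊕-identity = norm-≈ , λ p → ≈-trans (⊕≈addR p []) (addR-identityʳ p ≈-refl)

  ⊗-identityˡ : ∀ p → one ⊗ p ≈ p
  ⊗-identityˡ p = ≈-trans (⊗≈mulR one p) (mulR-identityˡ p)

  ⊕-inverse : Inverse [] neg _⊕_
  ⊕-inverse = (λ p → ≈-trans (⊕≈addR (neg p) p) (≈-trans (addR-comm (neg p) p) (addR-inverseʳ p)))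
            , (λ p → ≈-trans (⊕≈addR p (neg p)) (addR-inverseʳ p))

  -- The operations are literally _⊕_ and _⊗_, so prodR is the product ∏ of this ring.
  Pol-commutativeRing : CommutativeRing 0ℓ 0ℓ
  Pol-commutativeRing = record
    { Carrier = Pol ; _≈_ = _≈_ ; _+_ = _⊕_ ; _*_ = _⊗_ ; -_ = neg ; 0# = [] ; 1# = one
    ; isCommutativeRing = record
      { isRing = record
        { +-isAbelianGroup = record
          { isGroup = record
            { isMonoid = record
              { isSemigroup = record
                { isMagma = record { isEquivalence = ≈-isEquivalence ; ∙-cong = ⊕-cong }
                ; assoc = ⊕-assoc }
              ; identity = ⊕-identity }
            ; inverse = ⊕-inverse
            ; ⁻¹-cong = neg-cong }
          ; comm = ⊕-comm }
        ; *-cong = ⊗-cong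
        ; *-assoc = ⊗-assoc
        ; *-identity = ⊗-identityˡ , comm∧idˡ⇒idʳ ⊗-comm ⊗-identityˡ
        ; distrib = comm∧distrʳ⇒distrˡ ⊕-cong ⊗-comm ⊗-distribʳ , ⊗-distribʳ }
      ; *-comm = ⊗-comm } }
    where open SetoidConsequences ≈-setoid using (comm∧idˡ⇒idʳ; comm∧distrʳ⇒distrˡ)

  normCons-∷∷ : ∀ b {X c cs} → normCons b X ≡ b ∷ c ∷ cs → X ≡ c ∷ cs
  normCons-∷∷ b {y ∷ ys} refl = refl
  normCons-∷∷ b {[]} e with b Fin.≟ 0F
  normCons-∷∷ b {[]} () | yes _
  normCons-∷∷ b {[]} () | no _

  normal-∷∷ : ∀ {b c cs} → Normal (b ∷ c ∷ cs) → Normal (c ∷ cs)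
  normal-∷∷ {b} {c} {cs} nb = normCons-∷∷ b (trans (sym (norm-∷ b (c ∷ cs))) nb)

  normal-const : ∀ {b} → Normal (b ∷ []) → b ≢ 0F
  normal-const {b} nb b≡0 with () ←
    trans (sym (norm-[] (≈-trans (∷-cong b≡0 ≈-refl) (≈-sym []≈0∷[])))) nb

  normal-lead : ∀ b bs → Normal (b ∷ bs) → coeff (b ∷ bs) (length bs) ≢ 0F
  normal-lead b [] nb = normal-const nb
  normal-lead b (c ∷ cs) nb = normal-lead c cs (normal-∷∷ nb)

  ⊗-normal : ∀ p r → Normal (p ⊗ r)
  ⊗-normal p r = norm-normal (mulR p r)

  ⊖-normal : ∀ p r → Normal (p ⊖ r)
  ⊖-normal p r = norm-normal (addR p (neg r))

  -- size p is deg p + 1 for p ≉ [] and 0 for p ≈ [].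
  size : Pol → ℕ
  size p = length (norm p)

  VanishesFrom : Pol → ℕ → Set
  VanishesFrom p n = ∀ m → n ≤ m → coeff p m ≡ 0F

  size-resp : ∀ {p r} → p ≈ r → size p ≡ size r
  size-resp e = cong length (norm-resp e)

  size-norm : ∀ p → size (norm p) ≡ size p
  size-norm p = size-resp (norm-≈ p)

  length-vanishes : ∀ p → VanishesFrom p (length p)
  length-vanishes [] m _ = refl
  length-vanishes (a ∷ as) (suc m) (s≤s le) = length-vanishes as m le

  size≤⇒vanishes : ∀ p {n} → size p ≤ n → VanishesFrom p n
  size≤⇒vanishes p le m n≤m =
    trans (sym (coeff-≡ (norm-≈ p) m)) (length-vanishes (norm p) m (≤-trans le n≤m))

  size-lead : ∀ p {n} → size p ≡ suc n → coeff p n ≢ 0F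
  size-lead p {n} e with norm p in eq
  ... | b ∷ bs with refl ← e = λ lead≡0 → normal-lead b bs (subst Normal eq (norm-normal p)) (begin
    coeff (b ∷ bs) (length bs)   ≡⟨ cong (λ u → coeff u (length bs)) eq ⟨
    coeff (norm p) (length bs)   ≡⟨ coeff-≡ (norm-≈ p) (length bs) ⟩
    coeff p (length bs)          ≡⟨ lead≡0 ⟩
    0F                           ∎)
    where open ≡-Reasoning

  vanishes⇒size≤ : ∀ p {n} → VanishesFrom p n → size p ≤ n
  vanishes⇒size≤ p {n} v with ≤-<-connex (size p) n
  ... | inj₁ le = le
  ... | inj₂ gt with size p in eq
  ... | suc s = contradiction (v s (≤-pred gt)) (size-lead p eq)

  size≡ : ∀ p {n} → coeff p n ≢ 0F → VanishesFrom p (suc n) → size p ≡ suc n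
  size≡ p {n} lead≢0 v =
    ≤-antisym (vanishes⇒size≤ p v) (≰⇒> λ le → lead≢0 (size≤⇒vanishes p le n ≤-refl))

  size≡0⇒≈[] : ∀ p → size p ≡ 0 → p ≈ []
  size≡0⇒≈[] p e = mk≈ λ m → size≤⇒vanishes p (≤-reflexive e) m z≤n

  ≈[]⇒size≡0 : ∀ {p} → p ≈ [] → size p ≡ 0
  ≈[]⇒size≡0 e = cong length (norm-[] e)

  normal-size≡0 : ∀ {f} → Normal f → size f ≡ 0 → f ≡ []
  normal-size≡0 {f} nf sf = trans (sym nf) (norm-[] (size≡0⇒≈[] f sf))

  size≡suc : ∀ p → ¬ (p ≈ []) → ∃ λ i → size p ≡ suc i
  size≡suc p p≉[] with size p in eq
  ... | zero = contradiction (size≡0⇒≈[] p eq) p≉[]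
  ... | suc i = i , refl

  size≡1+deg : ∀ {f} → Normal f → 1 ≤ deg f → size f ≡ suc (deg f)
  size≡1+deg {a ∷ as} nf _ = cong length nf

  size-const : ∀ {c} → c ≢ 0F → size (c ∷ []) ≡ 1
  size-const {c} c≢0 = size≡ (c ∷ []) c≢0 λ { (suc m) _ → refl }

  size≡1⇒≈const : ∀ g → size g ≡ 1 → g ≈ (coeff g 0 ∷ [])
  size≡1⇒≈const g sg = mk≈ λ where
    zero → refl
    (suc n) → size≤⇒vanishes g (≤-reflexive sg) (suc n) (s≤s z≤n)

  coeff-tpow : ∀ d → coeff (tpow d) d ≡ 1F
  coeff-tpow zero = refl
  coeff-tpow (suc d) = coeff-tpow d

  size-tpow : ∀ d → size (tpow d) ≡ suc d
  size-tpow d = size≡ (tpow d) (λ 1≡0 → case trans (sym (coeff-tpow d)) 1≡0 of λ ()) (vanishes d)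
    where
    vanishes : ∀ d → VanishesFrom (tpow d) (suc d)
    vanishes zero (suc m) _ = refl
    vanishes (suc d) (suc m) (s≤s d<m) = vanishes d m d<m

  coeff-⊕ : ∀ p r n → coeff (p ⊕ r) n ≡ coeff p n + coeff r n
  coeff-⊕ p r n = trans (coeff-≡ (⊕≈addR p r) n) (coeff-addR p r n)

  coeff-⊖ : ∀ p r n → coeff (p ⊖ r) n ≡ coeff p n + - coeff r n
  coeff-⊖ p r n = trans (coeff-⊕ p (neg r) n) (cong (coeff p n +_) (coeff-neg r n))

  coeff-const-⊗ : ∀ c p n → coeff ((c ∷ []) ⊗ p) n ≡ c * coeff p n
  coeff-const-⊗ c p n = trans (coeff-≡ (⊗≈mulR (c ∷ []) p) n)
    (trans (coeff-≡ (mulR-constˡ c p) n) (coeff-scale c p n))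

  ⊖-vanishes : ∀ p r {n} → VanishesFrom p n → VanishesFrom r n → VanishesFrom (p ⊖ r) n
  ⊖-vanishes p r vp vr m n≤m = begin
    coeff (p ⊖ r) m           ≡⟨ coeff-⊖ p r m ⟩
    coeff p m + - coeff r m   ≡⟨ cong₂ (λ x y → x + - y) (vp m n≤m) (vr m n≤m) ⟩
    0F + - 0F                 ≡⟨ -‿inverseʳ 0F ⟩
    0F                        ∎
    where open ≡-Reasoning

  size-⊖-≤ : ∀ p r {n} → size p ≤ n → size r ≤ n → size (p ⊖ r) ≤ n
  size-⊖-≤ p r sp sr =
    vanishes⇒size≤ (p ⊖ r) (⊖-vanishes p r (size≤⇒vanishes p sp) (size≤⇒vanishes r sr))

  size-⊖-cancel : ∀ p r {d} → size p ≤ suc d → size r ≤ suc d → coeff p d ≡ coeff r d →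
                  size (p ⊖ r) ≤ d
  size-⊖-cancel p r {d} sp sr same-lead = vanishes⇒size≤ (p ⊖ r) λ m d≤m →
    case m≤n⇒m<n∨m≡n d≤m of λ where
      (inj₁ d<m) → ⊖-vanishes p r (size≤⇒vanishes p sp) (size≤⇒vanishes r sr) m d<m
      (inj₂ refl) → trans (coeff-⊖ p r d) (trans (cong (_+ - coeff r d) same-lead) (-‿inverseʳ _))

  coeff-mulR-∷ : ∀ a as r m → coeff (mulR (a ∷ as) r) m ≡ a * coeff r m + coeff (shift (mulR as r)) m
  coeff-mulR-∷ a as r m =
    trans (coeff-addR (scale a r) (shift (mulR as r)) m) (cong (_+ _) (coeff-scale a r m))

  mulR-vanishes : ∀ p r i j → VanishesFrom p (suc i) → VanishesFrom r (suc j) →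
                  VanishesFrom (mulR p r) (suc (i ℕ.+ j))
  mulR-vanishes [] r i j vp vr m lt = refl
  mulR-vanishes (a ∷ as) r i j vp vr (suc m) (s≤s i+j≤m) = begin
    coeff (mulR (a ∷ as) r) (suc m)             ≡⟨ coeff-mulR-∷ a as r (suc m) ⟩
    a * coeff r (suc m) + coeff (mulR as r) m
      ≡⟨ cong₂ _+_ (cong (a *_) (vr (suc m) (s≤s (≤-trans (m≤n+m j i) i+j≤m))))
                   (tail-vanishes i vp i+j≤m) ⟩
    a * 0F + 0F                                 ≡⟨ trans (+-identityʳ _) (zeroʳ a) ⟩
    0F                                          ∎
    where
    open ≡-Reasoning
    tail-vanishes : ∀ i → VanishesFrom (a ∷ as) (suc i) → i ℕ.+ j ≤ m → coeff (mulR as r) m ≡ 0F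
    tail-vanishes zero vp _ = coeff-≡ (mulR-zeroˡ {as} r (mk≈ λ n → vp (suc n) (s≤s z≤n))) m
    tail-vanishes (suc i) vp i+j≤m = mulR-vanishes as r i j (λ n lt → vp (suc n) (s≤s lt)) vr m i+j≤m

  coeff-mulR-top : ∀ p r i j → VanishesFrom p (suc i) → VanishesFrom r (suc j) →
                   coeff (mulR p r) (i ℕ.+ j) ≡ coeff p i * coeff r j
  coeff-mulR-top [] r i j vp vr = sym (zeroˡ _)
  coeff-mulR-top (a ∷ as) r zero j vp vr = begin
    coeff (mulR (a ∷ as) r) j                     ≡⟨ coeff-mulR-∷ a as r j ⟩
    a * coeff r j + coeff (shift (mulR as r)) j
      ≡⟨ cong (a * coeff r j +_) (coeff-≡ (shift-[] (mulR-zeroˡ r as≈[])) j) ⟩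
    a * coeff r j + 0F                            ≡⟨ +-identityʳ _ ⟩
    a * coeff r j                                 ∎
    where
    open ≡-Reasoning
    as≈[] : as ≈ []
    as≈[] = mk≈ λ n → vp (suc n) (s≤s z≤n)
  coeff-mulR-top (a ∷ as) r (suc i) j vp vr = begin
    coeff (mulR (a ∷ as) r) (suc (i ℕ.+ j))                     ≡⟨ coeff-mulR-∷ a as r (suc (i ℕ.+ j)) ⟩
    a * coeff r (suc (i ℕ.+ j)) + coeff (mulR as r) (i ℕ.+ j)
      ≡⟨ cong₂ _+_ (cong (a *_) (vr _ (s≤s (m≤n+m j i))))
                   (coeff-mulR-top as r i j (λ n lt → vp (suc n) (s≤s lt)) vr) ⟩
    a * 0F + coeff as i * coeff r j                             ≡⟨ cong (_+ coeff as i * coeff r j) (zeroʳ a) ⟩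
    0F + coeff as i * coeff r j                                 ≡⟨ +-identityˡ _ ⟩
    coeff as i * coeff r j                                      ∎
    where open ≡-Reasoning

  size-⊗ : ∀ p r {i j} → size p ≡ suc i → size r ≡ suc j → size (p ⊗ r) ≡ suc (i ℕ.+ j)
  size-⊗ p r {i} {j} sp sr =
    trans (size-resp (⊗≈mulR p r)) (size≡ (mulR p r) top≢0 (mulR-vanishes p r i j vp vr))
    where
    vp = size≤⇒vanishes p (≤-reflexive sp)
    vr = size≤⇒vanishes r (≤-reflexive sr)
    top≢0 : coeff (mulR p r) (i ℕ.+ j) ≢ 0F
    top≢0 top≡0 =
      *-nonzero (size-lead p sp) (size-lead r sr) (trans (sym (coeff-mulR-top p r i j vp vr)) top≡0)

  -- Units, division with remainder and irreducible factors

  module P = CommutativeRing Pol-commutativeRing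
  module PR = RingProperties P.ring
  open ProductOverRange P.*-commutativeMonoid using (∏; factor∣∏; distinctFactors∣∏)
  open import Algebra.Properties.Semiring.Divisibility P.semiring
    using (_∣_; _,_; ∣ʳ-trans; ∣ʳ-reflexive; ∣ʳ-respʳ-≈; x∣ʳy⇒x∣ʳzy; x∣ʳyx)
  open import Algebra.Properties.CommutativeSemigroup.Divisibility P.*-commutativeSemigroup
    using (x∣xy)
  open CommutativeSemigroupProperties P.*-commutativeSemigroup using (x∙yz≈y∙xz)
  open RingDivisibility P.ring using (∣x∣y⇒∣x-y)

  x+[y-x]≈y : ∀ x y → x ⊕ (y ⊖ x) ≈ y
  x+[y-x]≈y x y = P.trans (P.sym (P.+-assoc x y (neg x))) (PR.xyx⁻¹≈y x y)

  x-[x-y]≈y : ∀ x y → x ⊖ (x ⊖ y) ≈ y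
  x-[x-y]≈y x y = P.trans (P.+-congˡ {x} (PR.⁻¹-anti-homo-// x y)) (x+[y-x]≈y x y)

  ⊗-nonzero-factors : ∀ p r → ¬ (p ⊗ r ≈ []) → ¬ (p ≈ []) × ¬ (r ≈ [])
  ⊗-nonzero-factors p r pr≉[] =
    (λ p≈[] → pr≉[] (P.trans (P.*-congʳ {r} p≈[]) (P.zeroˡ r))) ,
    (λ r≈[] → pr≉[] (P.trans (P.*-congˡ {p} r≈[]) (P.zeroʳ p)))

  unit⇒size≡1 : ∀ g → IsUnit g → size g ≡ 1
  unit⇒size≡1 g (h , gh≡one) = trans (proj₂ g-size) (cong suc (m+n≡0⇒m≡0 _ (suc-injective sizes)))
    where
    gh≉[] : ¬ (g ⊗ h ≈ [])
    gh≉[] gh≈[] with () ← coeff-≡ (P.trans (P.reflexive (sym gh≡one)) gh≈[]) 0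
    g-size = size≡suc g (proj₁ (⊗-nonzero-factors g h gh≉[]))
    h-size = size≡suc h (proj₂ (⊗-nonzero-factors g h gh≉[]))
    sizes : suc (proj₁ g-size ℕ.+ proj₁ h-size) ≡ 1
    sizes = trans (sym (size-⊗ g h (proj₂ g-size) (proj₂ h-size))) (cong size gh≡one)

  size≡1⇒unit : ∀ g → size g ≡ 1 → IsUnit g
  size≡1⇒unit g sg = (c⁻¹ ∷ []) , normal-≈⇒≡ (⊗-normal g (c⁻¹ ∷ [])) refl (begin
    g ⊗ (c⁻¹ ∷ [])      ≈⟨ ⊗≈mulR g (c⁻¹ ∷ []) ⟩
    mulR g (c⁻¹ ∷ [])   ≈⟨ mulR-constʳ g c⁻¹ ⟩
    scale c⁻¹ g         ≈⟨ scale-cong c⁻¹ (size≡1⇒≈const g sg) ⟩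
    (c⁻¹ * c ∷ [])      ≈⟨ ∷-cong (inv-inverseˡ c c≢0) ≈-refl ⟩
    one                 ∎)
    where
    open SetoidReasoning ≈-setoid
    c = coeff g 0
    c≢0 = size-lead g sg
    c⁻¹ = inv c c≢0

  ∣one⇒unit : ∀ {f} → f ∣ one → IsUnit f
  ∣one⇒unit {f} (q , qf≈one) = q , normal-≈⇒≡ (⊗-normal f q) refl (P.trans (P.*-comm f q) qf≈one)

  unit-∣-cancel : ∀ {f} u b → IsUnit u → f ∣ u ⊗ b → f ∣ b
  unit-∣-cancel {f} u b (v , uv≡one) f∣ub = ∣ʳ-respʳ-≈ (begin
    v ⊗ (u ⊗ b)   ≈⟨ P.*-assoc v u b ⟨
    (v ⊗ u) ⊗ b   ≈⟨ P.*-congʳ (P.trans (P.*-comm v u) (P.reflexive uv≡one)) ⟩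
    one ⊗ b       ≈⟨ P.*-identityˡ b ⟩
    b             ∎) (x∣ʳy⇒x∣ʳzy v f∣ub)
    where open SetoidReasoning ≈-setoid

  shift-⊗ : ∀ p r → shift p ⊗ r ≈ shift (p ⊗ r)
  shift-⊗ p r = ≈-trans (⊗≈mulR (shift p) r)
    (≈-trans (mulR-shiftˡ p r) (∷-cong refl (≈-sym (⊗≈mulR p r))))

  ∷-⊕ : ∀ c p r → (c ∷ (p ⊕ r)) ≈ shift p ⊕ (c ∷ r)
  ∷-⊕ c p r = mk≈ λ where
    zero → trans (sym (+-identityˡ c)) (sym (coeff-⊕ (shift p) (c ∷ r) 0))
    (suc n) → trans (coeff-⊕ p r n) (sym (coeff-⊕ (shift p) (c ∷ r) (suc n)))

  cancel-lead : ∀ g {n} → size g ≡ suc n → ∀ s → size s ≤ suc n →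
                ∃ λ e → size (s ⊖ ((e ∷ []) ⊗ g)) ≤ n
  cancel-lead g {n} sg s ss = e , size-⊖-cancel s ((e ∷ []) ⊗ g) ss eg-small (sym eg-lead)
    where
    open ≡-Reasoning
    lg = coeff g n
    lg≢0 = size-lead g sg
    e = coeff s n * inv lg lg≢0
    eg-small : size ((e ∷ []) ⊗ g) ≤ suc n
    eg-small = vanishes⇒size≤ ((e ∷ []) ⊗ g) λ m n<m →
      trans (coeff-const-⊗ e g m) (trans (cong (e *_) (size≤⇒vanishes g (≤-reflexive sg) m n<m)) (zeroʳ e))
    eg-lead : coeff ((e ∷ []) ⊗ g) n ≡ coeff s n
    eg-lead = begin
      coeff ((e ∷ []) ⊗ g) n             ≡⟨ coeff-const-⊗ e g n ⟩
      (coeff s n * inv lg lg≢0) * lg     ≡⟨ *-assoc (coeff s n) (inv lg lg≢0) lg ⟩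
      coeff s n * (inv lg lg≢0 * lg)     ≡⟨ cong (coeff s n *_) (inv-inverseˡ lg lg≢0) ⟩
      coeff s n * 1F                     ≡⟨ *-identityʳ (coeff s n) ⟩
      coeff s n                          ∎

  record Division (f g : Pol) : Set where
    field
      quotient remainder : Pol
      f≈qg+r : f ≈ (quotient ⊗ g) ⊕ remainder
      remainder<g : size remainder < size g

  -- Induction on the coefficient list of f: after dividing its tail, one cancellation of the top
  -- coefficient suffices.
  divide : ∀ g {n} → size g ≡ suc n → ∀ f → Division f g
  divide g sg [] = record
    { quotient = [] ; remainder = [] ; f≈qg+r = ≈-refl ; remainder<g = subst (0 <_) (sym sg) (s≤s z≤n) }
  divide g {n} sg (c ∷ f) = record
    { quotient = shift q′ ⊕ eC
    ; remainder = s ⊖ (eC ⊗ g)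
    ; f≈qg+r = begin
        (c ∷ f)                                      ≈⟨ ∷-cong refl f≈qg+r ⟩
        (c ∷ ((q′ ⊗ g) ⊕ r′))                        ≈⟨ ∷-⊕ c (q′ ⊗ g) r′ ⟩
        shift (q′ ⊗ g) ⊕ s                           ≈⟨ P.+-congʳ {s} (shift-⊗ q′ g) ⟨
        (shift q′ ⊗ g) ⊕ s                           ≈⟨ P.+-congˡ {shift q′ ⊗ g} (x+[y-x]≈y eg s) ⟨
        (shift q′ ⊗ g) ⊕ (eg ⊕ (s ⊖ eg))             ≈⟨ P.+-assoc (shift q′ ⊗ g) eg _ ⟨
        ((shift q′ ⊗ g) ⊕ eg) ⊕ (s ⊖ eg)             ≈⟨ P.+-congʳ {s ⊖ eg} (P.distribʳ g (shift q′) eC) ⟨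
        ((shift q′ ⊕ eC) ⊗ g) ⊕ (s ⊖ eg)             ∎
    ; remainder<g = subst (size (s ⊖ (eC ⊗ g)) <_) (sym sg) (s≤s (proj₂ (cancel-lead g sg s s-small))) }
    where
    open Division (divide g sg f) renaming (quotient to q′; remainder to r′)
    open SetoidReasoning ≈-setoid
    s = c ∷ r′
    s-small : size s ≤ suc n
    s-small = vanishes⇒size≤ s λ where
      (suc m) (s≤s n≤m) → size≤⇒vanishes r′ (≤-pred (subst (size r′ <_) sg remainder<g)) m n≤m
    eC = proj₁ (cancel-lead g sg s s-small) ∷ []
    eg = eC ⊗ g

  irreducible⇒2≤size : ∀ {f} → Normal f → Irreducible f → 2 ≤ size f
  irreducible⇒2≤size {f} nf (f≢[] , f-nonunit , _) with size f in sf
  ... | zero = contradiction (normal-size≡0 nf sf) f≢[]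
  ... | suc zero = contradiction (size≡1⇒unit f sf) f-nonunit
  ... | suc (suc _) = s≤s (s≤s z≤n)

  module _ {f} (f-normal : Normal f) (f-irreducible : Irreducible f) where

    -- Euclid's lemma for divisors g of smaller degree: replace g by the remainder of f modulo g.
    irreducible⇒prime : ∀ g b → 1 ≤ size g → size g < size f → f ∣ g ⊗ b → f ∣ b
    irreducible⇒prime g b 1≤sg = go (<-wellFounded (size g)) g b refl 1≤sg
      where
      go : ∀ {n} → Acc _<_ n → ∀ g b → size g ≡ n → 1 ≤ n → n < size f → f ∣ g ⊗ b → f ∣ b
      go {suc zero} _ g b sg _ _ f∣gb = unit-∣-cancel g b (size≡1⇒unit g sg) f∣gb
      go {suc (suc n)} (acc smaller) g b sg _ n<sf f∣gb with size (Division.remainder (divide g sg f)) in sr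
      ... | zero = ⊥-elim ([ quotient-nonunit , g-nonunit ]′ (proj₂ (proj₂ f-irreducible) quotient g f≡qg))
        where
        open Division (divide g sg f)
        f≡qg : quotient ⊗ g ≡ f
        f≡qg = normal-≈⇒≡ (⊗-normal quotient g) f-normal (P.sym (P.trans f≈qg+r
          (P.trans (P.+-congˡ {quotient ⊗ g} (size≡0⇒≈[] _ sr)) (P.+-identityʳ _))))
        g-nonunit : ¬ IsUnit g
        g-nonunit g-unit with () ← trans (sym sg) (unit⇒size≡1 g g-unit)
        quotient-nonunit : ¬ IsUnit quotient
        quotient-nonunit q-unit = <-irrefl (trans (sym sqg) (cong size f≡qg)) n<sf
          where sqg = size-⊗ quotient g (unit⇒size≡1 quotient q-unit) sg
      ... | suc m = go (smaller r<g) remainder b sr (s≤s z≤n) (<-trans r<g n<sf)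
          (∣ʳ-respʳ-≈ (P.sym rb≈fb-qgb) (∣x∣y⇒∣x-y (x∣xy f b) (x∣ʳy⇒x∣ʳzy quotient f∣gb)))
        where
        open Division (divide g sg f)
        r<g : suc m < suc (suc n)
        r<g = subst₂ _<_ sr sg remainder<g
        r≈f-qg : remainder ≈ f ⊖ (quotient ⊗ g)
        r≈f-qg = P.trans (P.sym (PR.xyx⁻¹≈y (quotient ⊗ g) remainder)) (P.+-congʳ (P.sym f≈qg+r))
        rb≈fb-qgb : remainder ⊗ b ≈ (f ⊗ b) ⊖ (quotient ⊗ (g ⊗ b))
        rb≈fb-qgb = P.trans (P.*-congʳ {b} r≈f-qg) (P.trans (PR.[y-z]x≈yx-zx b f (quotient ⊗ g))
          (P.+-congˡ {f ⊗ b} (P.-‿cong (P.*-assoc quotient g b))))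

    ∤∏ : ∀ G N → (∀ m → m < N → 1 ≤ size (G m) × size (G m) < size f) →
         ¬ (f ∣ ∏ (applyDownFrom G N))
    ∤∏ G zero _ f∣one with s≤s () ← subst (2 ≤_) (unit⇒size≡1 f (∣one⇒unit f∣one))
                                            (irreducible⇒2≤size f-normal f-irreducible)
    ∤∏ G (suc N) small f∣∏ = ∤∏ G N (λ m m<N → small m (m<n⇒m<1+n m<N))
      (irreducible⇒prime (G N) _ (proj₁ (small N ≤-refl)) (proj₂ (small N ≤-refl)) f∣∏)

  -- The enumeration δ

  δ-normCons : ∀ a X → δ (normCons a X) ≡ toℕ a ℕ.+ q ℕ.* δ X
  δ-normCons a (b ∷ bs) = refl
  δ-normCons a [] with a Fin.≟ 0F
  ... | yes refl = sym (*-zeroʳ q)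
  ... | no _ = refl

  δ-norm : ∀ p → δ (norm p) ≡ δ p
  δ-norm [] = refl
  δ-norm (a ∷ as) rewrite norm-∷ a as =
    trans (δ-normCons a (norm as)) (cong (λ x → toℕ a ℕ.+ q ℕ.* x) (δ-norm as))

  δ-resp : ∀ {p r} → p ≈ r → δ p ≡ δ r
  δ-resp {p} {r} e = trans (sym (δ-norm p)) (trans (cong δ (norm-resp e)) (δ-norm r))

  base-q-digit-injective : ∀ (a b : F) x y →
                           toℕ a ℕ.+ q ℕ.* x ≡ toℕ b ℕ.+ q ℕ.* y → a ≡ b × x ≡ y
  base-q-digit-injective a b x y e =
    toℕ-injective a≡b ,
    *-cancelˡ-≡ x y q (+-cancelˡ-≡ (toℕ a) _ _ (trans e (cong (ℕ._+ q ℕ.* y) (sym a≡b))))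
    where
    last-digit : ∀ (c : F) z → (toℕ c ℕ.+ q ℕ.* z) % q ≡ toℕ c
    last-digit c z = trans (cong (λ u → (toℕ c ℕ.+ u) % q) (ℕP.*-comm q z))
                           (trans ([m+kn]%n≡m%n (toℕ c) z q) (m<n⇒m%n≡m (toℕ<n c)))
    a≡b : toℕ a ≡ toℕ b
    a≡b = trans (sym (last-digit a x)) (trans (cong (_% q) e) (last-digit b y))

  δ-injective : ∀ p r → δ p ≡ δ r → p ≈ r
  δ-injective [] [] e = ≈-refl
  δ-injective [] (b ∷ bs) e with base-q-digit-injective 0F b 0 (δ bs) (trans (*-zeroʳ q) e)
  ... | 0≡b , 0≡δbs = ≈-trans []≈0∷[] (∷-cong 0≡b (δ-injective [] bs 0≡δbs))
  δ-injective (a ∷ as) [] e with base-q-digit-injective a 0F (δ as) 0 (trans e (sym (*-zeroʳ q)))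
  ... | a≡0 , δas≡0 = ≈-trans (∷-cong a≡0 (δ-injective as [] δas≡0)) (≈-sym []≈0∷[])
  δ-injective (a ∷ as) (b ∷ bs) e with base-q-digit-injective a b (δ as) (δ bs) e
  ... | a≡b , δas≡δbs = ∷-cong a≡b (δ-injective as bs δas≡δbs)

  δ<q^length : ∀ p → δ p < q ^ length p
  δ<q^length [] = s≤s z≤n
  δ<q^length (a ∷ as) = begin-strict
    toℕ a ℕ.+ q ℕ.* δ as      <⟨ +-monoˡ-< (q ℕ.* δ as) (toℕ<n a) ⟩
    q ℕ.+ q ℕ.* δ as          ≡⟨ *-suc q (δ as) ⟨
    q ℕ.* suc (δ as)          ≤⟨ *-monoʳ-≤ q (δ<q^length as) ⟩
    q ℕ.* q ^ length as       ∎
    where open ≤-Reasoning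

  δ<q^size : ∀ p → δ p < q ^ size p
  δ<q^size p = subst (_< q ^ size p) (δ-norm p) (δ<q^length (norm p))

  normal⇒q^deg≤δ : ∀ b bs → Normal (b ∷ bs) → q ^ length bs ≤ δ (b ∷ bs)
  normal⇒q^deg≤δ b [] nb =
    ≤-trans (n≢0⇒n>0 (λ b≡0 → normal-const nb (toℕ-injective b≡0))) (m≤m+n (toℕ b) _)
  normal⇒q^deg≤δ b (c ∷ cs) nb =
    ≤-trans (*-monoʳ-≤ q (normal⇒q^deg≤δ c cs (normal-∷∷ nb))) (m≤n+m _ (toℕ b))

  q^≤δ : ∀ p {n} → size p ≡ suc n → q ^ n ≤ δ p
  q^≤δ p e with norm p in eq
  ... | b ∷ bs with refl ← e = subst (q ^ length bs ≤_) (trans (cong δ (sym eq)) (δ-norm p))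
                                     (normal⇒q^deg≤δ b bs (subst Normal eq (norm-normal p)))

  δ<q^⇒size≤ : ∀ p {d} → δ p < q ^ d → size p ≤ d
  δ<q^⇒size≤ p {d} δp<q^d with ≤-<-connex (size p) d
  ... | inj₁ le = le
  ... | inj₂ gt with size p in eq
  ... | suc n = contradiction (≤-trans (^-monoʳ-≤ q (≤-pred gt)) (q^≤δ p eq)) (<⇒≱ δp<q^d)

  size≤⇒δ<q^ : ∀ p {d} → size p ≤ d → δ p < q ^ d
  size≤⇒δ<q^ p sp = <-≤-trans (δ<q^size p) (^-monoʳ-≤ q sp)

  n<q^n : ∀ n → n < q ^ n
  n<q^n zero = s≤s z≤n
  n<q^n (suc n) = begin-strict
    suc n                 ≤⟨ n<q^n n ⟩
    q ^ n                 <⟨ m<m*n (q ^ n) q {{>-nonZero (m^n>0 q n)}} (s≤s (s≤s z≤n)) ⟩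
    q ^ n ℕ.* q           ≡⟨ ℕP.*-comm (q ^ n) q ⟩
    q ^ suc n             ∎
    where open ≤-Reasoning

  δ-digits : ∀ fuel m → m < q ^ fuel → δ (digits fuel m) ≡ m
  δ-digits zero zero _ = refl
  δ-digits zero (suc m) (s≤s ())
  δ-digits (suc fuel) m m<q^1+fuel = begin
    toℕ (fromℕ< (m%n<n m q)) ℕ.+ q ℕ.* δ (digits fuel (m / q))
      ≡⟨ cong₂ ℕ._+_ (toℕ-fromℕ< (m%n<n m q))
                     (cong (q ℕ.*_) (δ-digits fuel (m / q) (m<n*o⇒m/o<n m<q^fuel*q))) ⟩
    m % q ℕ.+ q ℕ.* (m / q)   ≡⟨ cong (m % q ℕ.+_) (ℕP.*-comm q (m / q)) ⟩
    m % q ℕ.+ (m / q) ℕ.* q   ≡⟨ m≡m%n+[m/n]*n m q ⟨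
    m                         ∎
    where
    open ≡-Reasoning
    m<q^fuel*q : m < q ^ fuel ℕ.* q
    m<q^fuel*q = subst (m <_) (ℕP.*-comm q (q ^ fuel)) m<q^1+fuel

  δ-polyOf : ∀ m → δ (polyOf m) ≡ m
  δ-polyOf m = trans (δ-norm (digits m m)) (δ-digits m m (n<q^n m))

  polyOf-normal : ∀ m → Normal (polyOf m)
  polyOf-normal m = norm-normal (digits m m)

  polyOf-δ : ∀ p → Normal p → polyOf (δ p) ≡ p
  polyOf-δ p np = normal-≈⇒≡ (polyOf-normal (δ p)) np (δ-injective _ _ (δ-polyOf (δ p)))

  δ-tpow : ∀ d → δ (tpow d) ≡ q ^ d
  δ-tpow zero = cong suc (*-zeroʳ q)
  δ-tpow (suc d) = cong (q ℕ.*_) (δ-tpow d)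

  -- Factorials

  map-upTo : ∀ (G : ℕ → Pol) N → map G (upTo N) ≡ applyDownFrom G N
  map-upTo G zero = refl
  map-upTo G (suc N) = cong (G N ∷_) (map-upTo G N)

  fact≡∏ : ∀ B → fact B ≡ ∏ (applyDownFrom (λ m → B ⊖ polyOf m) (δ B))
  fact≡∏ B = cong prodR (map-upTo (λ m → B ⊖ polyOf m) (δ B))

  fact-normal : ∀ B → Normal (fact B)
  fact-normal B = prodR-normal (map (λ m → B ⊖ polyOf m) (upTo (δ B)))
    where
    prodR-normal : ∀ L → Normal (prodR L)
    prodR-normal [] = refl
    prodR-normal (x ∷ xs) = ⊗-normal x (prodR xs)

  ∣⇒∣P : ∀ {x y} → Normal y → x ∣ y → x ∣P y
  ∣⇒∣P {x} ny (q , qx≈y) = q , normal-≈⇒≡ (⊗-normal x q) ny (P.trans (P.*-comm x q) qx≈y)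

  ∣P⇒∣ : ∀ {x y} → x ∣P y → x ∣ y
  ∣P⇒∣ {x} (h , xh≡y) = h , P.trans (P.*-comm h x) (P.reflexive xh≡y)

  factor-index : ∀ B X → Normal X → B ⊖ polyOf (δ (B ⊖ X)) ≡ X
  factor-index B X nX = normal-≈⇒≡ (⊖-normal B _) nX (P.trans
    (P.+-congˡ {B} (P.-‿cong (P.reflexive (polyOf-δ (B ⊖ X) (⊖-normal B X))))) (x-[x-y]≈y B X))

  factor∣fact : ∀ B X → Normal X → δ (B ⊖ X) < δ B → X ∣ fact B
  factor∣fact B X nX lt =
    subst₂ _∣_ (factor-index B X nX) (sym (fact≡∏ B)) (factor∣∏ (λ m → B ⊖ polyOf m) lt)

  distinctFactors∣fact : ∀ B X Y → Normal X → Normal Y → X ≢ Y →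
                         δ (B ⊖ X) < δ B → δ (B ⊖ Y) < δ B → X ⊗ Y ∣ fact B
  distinctFactors∣fact B X Y nX nY X≢Y ltX ltY =
    subst₂ (λ U V → U ⊗ V ∣ fact B) (factor-index B X nX) (factor-index B Y nY)
      (subst (G (δ (B ⊖ X)) ⊗ G (δ (B ⊖ Y)) ∣_) (sym (fact≡∏ B))
             (distinctFactors∣∏ G distinct-indices ltX ltY))
    where
    G : ℕ → Pol
    G m = B ⊖ polyOf m
    distinct-indices : δ (B ⊖ X) ≢ δ (B ⊖ Y)
    distinct-indices e = X≢Y (trans (sym (factor-index B X nX)) (trans (cong G e) (factor-index B Y nY)))

  monic∣fact-tpow : ∀ d u → Normal u → size u ≡ suc d → coeff u d ≡ 1F → u ∣ fact (tpow d)
  monic∣fact-tpow d u nu su monic = factor∣fact (tpow d) u nu (subst (δ (tpow d ⊖ u) <_) (sym (δ-tpow d))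
    (size≤⇒δ<q^ (tpow d ⊖ u) (size-⊖-cancel (tpow d) u (≤-reflexive (size-tpow d)) (≤-reflexive su)
                                                         (trans (coeff-tpow d) (sym monic)))))

  fact-factor-size : ∀ d h → δ h < q ^ d → ∀ m → m < δ h →
                     1 ≤ size (h ⊖ polyOf m) × size (h ⊖ polyOf m) ≤ d
  fact-factor-size d h δh<q^d m m<δh = nonzero , size-⊖-≤ h (polyOf m) (δ<q^⇒size≤ h δh<q^d)
    (δ<q^⇒size≤ (polyOf m) (subst (_< q ^ d) (sym (δ-polyOf m)) (<-trans m<δh δh<q^d)))
    where
    nonzero : 1 ≤ size (h ⊖ polyOf m)
    nonzero with size (h ⊖ polyOf m) in eq
    ... | suc _ = s≤s z≤n
    ... | zero = contradiction δh≡m (<⇒≢ m<δh ∘ sym)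
      where
      δh≡m : δ h ≡ m
      δh≡m = trans (δ-resp (PR.x∙y⁻¹≈ε⇒x≈y h (polyOf m) (size≡0⇒≈[] _ eq))) (δ-polyOf m)

  irreducible∤fact : ∀ {f d} → Normal f → Irreducible f → size f ≡ suc d →
                     ∀ h → δ h < q ^ d → ¬ (f ∣ fact h)
  irreducible∤fact {f} {d} nf irr sf h δh<q^d f∣h! =
    ∤∏ nf irr (λ m → h ⊖ polyOf m) (δ h) factor-sizes (subst (f ∣_) (fact≡∏ h) f∣h!)
    where
    factor-sizes : ∀ m → m < δ h → 1 ≤ size (h ⊖ polyOf m) × size (h ⊖ polyOf m) < size f
    factor-sizes m m<δh with fact-factor-size d h δh<q^d m m<δh
    ... | 1≤s , s≤d = 1≤s , subst (size (h ⊖ polyOf m) <_) (sym sf) (s≤s s≤d)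

  NonzeroSize≤ : ℕ → Pol → Set
  NonzeroSize≤ d X = Normal X × 1 ≤ size X × size X ≤ d

  nonzeroSize≤ : ∀ g {s d} → Normal g → size g ≡ suc s → s < d → NonzeroSize≤ d g
  nonzeroSize≤ g ng sg s<d = ng , subst (1 ≤_) (sym sg) (s≤s z≤n) , subst (_≤ _) (sym sg) s<d

  -- The polynomial H of the proof idea: the largest one of degree < d.
  top : ℕ → Pol
  top d = polyOf (q ^ d ∸ 1)

  δ-top<q^ : ∀ d → δ (top d) < q ^ d
  δ-top<q^ d = subst (_< q ^ d) (sym (δ-polyOf (q ^ d ∸ 1))) (∸-monoʳ-< {n = 1} (s≤s z≤n) (m^n>0 q d))

  δ-top⊖<δ-top : ∀ d X → 1 ≤ size X → size X ≤ d → δ (top d ⊖ X) < δ (top d)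
  δ-top⊖<δ-top d X 1≤sX sX≤d = ≤∧≢⇒< δ≤ δ≢
    where
    size-top⊖X≤d : size (top d ⊖ X) ≤ d
    size-top⊖X≤d = size-⊖-≤ (top d) X (δ<q^⇒size≤ (top d) (δ-top<q^ d)) sX≤d
    δ≤ : δ (top d ⊖ X) ≤ δ (top d)
    δ≤ = subst (δ (top d ⊖ X) ≤_) (sym (δ-polyOf (q ^ d ∸ 1)))
               (∸-monoˡ-≤ 1 (size≤⇒δ<q^ (top d ⊖ X) size-top⊖X≤d))
    X≈[] : δ (top d ⊖ X) ≡ δ (top d) → X ≈ []
    X≈[] e = P.trans (P.sym (x-[x-y]≈y (top d) X))
                     (P.trans (P.+-congˡ {top d} (P.-‿cong (δ-injective _ _ e))) (P.-‿inverseʳ (top d)))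
    δ≢ : δ (top d ⊖ X) ≢ δ (top d)
    δ≢ e with () ← subst (1 ≤_) (≈[]⇒size≡0 (X≈[] e)) 1≤sX

  distinctNonzero∣fact-top : ∀ d X Y → NonzeroSize≤ d X → NonzeroSize≤ d Y → X ≢ Y →
                             X ⊗ Y ∣ fact (top d)
  distinctNonzero∣fact-top d X Y (nX , 1≤sX , sX≤d) (nY , 1≤sY , sY≤d) X≢Y =
    distinctFactors∣fact (top d) X Y nX nY X≢Y
      (δ-top⊖<δ-top d X 1≤sX sX≤d) (δ-top⊖<δ-top d Y 1≤sY sY≤d)

  record DistinctSmallFactors (d : ℕ) (f : Pol) : Set where
    field
      X Y : Pol
      X-small : NonzeroSize≤ d X
      Y-small : NonzeroSize≤ d Y
      X≢Y : X ≢ Y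
      f∣XY : f ∣ X ⊗ Y

  distinctSmallFactors∣fact-top : ∀ {d f} → DistinctSmallFactors d f → f ∣ fact (top d)
  distinctSmallFactors∣fact-top {d} D = ∣ʳ-trans f∣XY (distinctNonzero∣fact-top d X Y X-small Y-small X≢Y)
    where open DistinctSmallFactors D

  NotScaledSquareOfMonicLinear : Pol → Set
  NotScaledSquareOfMonicLinear f = ∀ b c → f ≢ (b ∷ []) ⊗ ((c ∷ 1F ∷ []) ⊗ (c ∷ 1F ∷ []))

  square∣g⊗ug : ∀ {f} g u → g ⊗ g ≈ f → f ∣ g ⊗ (u ⊗ g)
  square∣g⊗ug {f} g u gg≈f = u , P.trans (P.*-congˡ {u} (P.sym gg≈f)) (x∙yz≈y∙xz u g g)

  length≡2 : ∀ (g : Pol) → length g ≡ 2 → ∃ λ c → ∃ λ e → g ≡ c ∷ e ∷ []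
  length≡2 (c ∷ e ∷ []) refl = c , e , refl

  module _ {f g} (f-normal : Normal f) (g-normal : Normal g) (gg≈f : g ⊗ g ≈ f) where

    scaledSquareFactors : 3 ≤ q → ∀ {i} → size g ≡ suc i → 1 ≤ i → DistinctSmallFactors (i ℕ.+ i) f
    scaledSquareFactors 3≤q {i} sg 1≤i = record
      { X = g
      ; Y = (two ∷ []) ⊗ g
      ; X-small = nonzeroSize≤ g g-normal sg (m<m+n i 1≤i)
      ; Y-small = nonzeroSize≤ ((two ∷ []) ⊗ g) (⊗-normal (two ∷ []) g)
                               (size-⊗ (two ∷ []) g (size-const two≢0) sg) (m<m+n i 1≤i)
      ; X≢Y = λ g≡2g → two≢1 (*≡⇒≡1 (size-lead g sg)
                (sym (trans (cong (λ p → coeff p i) g≡2g) (coeff-const-⊗ two g i))))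
      ; f∣XY = square∣g⊗ug g (two ∷ []) gg≈f }
      where
      two = fromℕ< 3≤q
      two≢0 : two ≢ 0F
      two≢0 two≡0 with () ← trans (sym (toℕ-fromℕ< 3≤q)) (cong toℕ two≡0)
      two≢1 : two ≢ 1F
      two≢1 two≡1 with () ← trans (sym (toℕ-fromℕ< 3≤q)) (cong toℕ two≡1)

    shiftedSquareFactors : ∀ {i} → size g ≡ suc i → 2 ≤ i → DistinctSmallFactors (i ℕ.+ i) f
    shiftedSquareFactors {suc i} sg (s≤s 1≤i) = record
      { X = g
      ; Y = tpow 1 ⊗ g
      ; X-small = nonzeroSize≤ g g-normal sg (m<m+n (suc i) (s≤s z≤n))
      ; Y-small = nonzeroSize≤ (tpow 1 ⊗ g) (⊗-normal (tpow 1) g) stg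
                    (s≤s (subst (suc (suc i) ≤_) (sym (ℕP.+-suc i i)) (s≤s (m<m+n i 1≤i))))
      ; X≢Y = λ g≡tg → 1+n≢n (trans (sym (trans (cong size g≡tg) stg)) sg)
      ; f∣XY = square∣g⊗ug g (tpow 1) gg≈f }
      where
      stg = size-⊗ (tpow 1) g (size-tpow 1) sg

    linearSquare : ¬ (3 ≤ q) → size g ≡ 2 → ¬ NotScaledSquareOfMonicLinear f
    linearSquare 3≰q sg not-square with length≡2 g (trans (cong length (sym g-normal)) sg)
    ... | c , e , refl = not-square 1F c (normal-≈⇒≡ f-normal (⊗-normal (1F ∷ []) L²) (begin
      f                               ≈⟨ gg≈f ⟨
      (c ∷ e ∷ []) ⊗ (c ∷ e ∷ [])     ≡⟨ cong (λ x → (c ∷ x ∷ []) ⊗ (c ∷ x ∷ [])) e≡1 ⟩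
      L²                              ≈⟨ P.*-identityˡ L² ⟨
      (1F ∷ []) ⊗ L²                  ∎))
      where
      open SetoidReasoning ≈-setoid
      L² = (c ∷ 1F ∷ []) ⊗ (c ∷ 1F ∷ [])
      e≡1 : e ≡ 1F
      e≡1 = q≡2⇒nonzero≡1 3≰q e (normal-lead c (e ∷ []) g-normal)

    square⇒distinctSmallFactors : 3 ≤ q ⊎ NotScaledSquareOfMonicLinear f →
                                  ∀ {i} → size g ≡ suc i → 1 ≤ i → DistinctSmallFactors (i ℕ.+ i) f
    square⇒distinctSmallFactors hyp sg 1≤i with 3 ≤? q | hyp | m≤n⇒m<n∨m≡n 1≤i
    ... | yes 3≤q | _ | _ = scaledSquareFactors 3≤q sg 1≤i
    ... | no 3≰q | inj₁ 3≤q | _ = contradiction 3≤q 3≰q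
    ... | no 3≰q | inj₂ _ | inj₁ 2≤i = shiftedSquareFactors sg 2≤i
    ... | no 3≰q | inj₂ not-square | inj₂ refl = contradiction not-square (linearSquare 3≰q sg)

  factorisation⇒distinctSmallFactors :
    ∀ {f} → Normal f → 3 ≤ q ⊎ NotScaledSquareOfMonicLinear f →
    ∀ g h {i j} → Normal g → Normal h → g ⊗ h ≈ f →
    size g ≡ suc i → size h ≡ suc j → 1 ≤ i → 1 ≤ j → DistinctSmallFactors (i ℕ.+ j) f
  factorisation⇒distinctSmallFactors {f} nf hyp g h {i} {j} ng nh gh≈f sg sh 1≤i 1≤j
    with ≡-dec Fin._≟_ g h
  ... | no g≢h = record
    { X = g
    ; Y = h
    ; X-small = nonzeroSize≤ g ng sg (m<m+n i 1≤j)
    ; Y-small = nonzeroSize≤ h nh sh (subst (j <_) (ℕP.+-comm j i) (m<m+n j 1≤i))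
    ; X≢Y = g≢h
    ; f∣XY = ∣ʳ-reflexive (P.sym gh≈f) }
  ... | yes refl = subst (λ j → DistinctSmallFactors (i ℕ.+ j) f) (suc-injective (trans (sym sg) sh))
                         (square⇒distinctSmallFactors nf ng gh≈f hyp sg 1≤i)

  irreducible⇒IsS : ∀ {f d} → Normal f → size f ≡ suc d → Irreducible f → IsS f (tpow d)
  irreducible⇒IsS {f} {d} nf sf irr =
    ∣⇒∣P (fact-normal (tpow d)) (∣ʳ-trans (x∣ʳyx f (c⁻¹ ∷ [])) monic∣fact) ,
    λ h _ δh<δt f∣h! → irreducible∤fact nf irr sf h (subst (δ h <_) (δ-tpow d) δh<δt) (∣P⇒∣ f∣h!)
    where
    c = coeff f d
    c≢0 = size-lead f sf
    c⁻¹ = inv c c≢0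
    monic∣fact : (c⁻¹ ∷ []) ⊗ f ∣ fact (tpow d)
    monic∣fact = monic∣fact-tpow d _ (⊗-normal (c⁻¹ ∷ []) f)
      (size-⊗ (c⁻¹ ∷ []) f (size-const (inv-nonzero c c≢0)) sf)
      (trans (coeff-const-⊗ c⁻¹ f d) (inv-inverseˡ c c≢0))

  IsS⇒irreducible : ∀ {f d} → Normal f → size f ≡ suc d → 1 ≤ d →
                    3 ≤ q ⊎ NotScaledSquareOfMonicLinear f → IsS f (tpow d) → Irreducible f
  IsS⇒irreducible {f} {d} nf sf 1≤d hyp (_ , minimal) = f≢[] , f-nonunit , indecomposable
    where
    f≢[] : f ≢ []
    f≢[] f≡[] = 0≢1+n (trans (sym (cong size f≡[])) sf)
    f-nonunit : ¬ IsUnit f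
    f-nonunit f-unit with () ← subst (1 ≤_) (suc-injective (trans (sym sf) (unit⇒size≡1 f f-unit))) 1≤d
    f∤fact-top : ¬ (f ∣ fact (top d))
    f∤fact-top f∣fact = minimal (top d) (polyOf-normal (q ^ d ∸ 1))
      (subst (δ (top d) <_) (sym (δ-tpow d)) (δ-top<q^ d)) (∣⇒∣P (fact-normal (top d)) f∣fact)
    indecomposable : ∀ g h → g ⊗ h ≡ f → IsUnit g ⊎ IsUnit h
    indecomposable g h gh≡f = by-sizes (size≡suc (norm g) g≉[]) (size≡suc (norm h) h≉[])
      where
      gh≈f : norm g ⊗ norm h ≈ f
      gh≈f = P.trans (P.*-cong (norm-≈ g) (norm-≈ h)) (P.reflexive gh≡f)
      gh≉[] : ¬ (norm g ⊗ norm h ≈ [])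
      gh≉[] gh≈[] = f≢[] (normal-size≡0 nf (trans (sym (size-resp gh≈f)) (≈[]⇒size≡0 gh≈[])))
      g≉[] = proj₁ (⊗-nonzero-factors (norm g) (norm h) gh≉[])
      h≉[] = proj₂ (⊗-nonzero-factors (norm g) (norm h) gh≉[])
      by-sizes : (∃ λ i → size (norm g) ≡ suc i) → (∃ λ j → size (norm h) ≡ suc j) →
                 IsUnit g ⊎ IsUnit h
      by-sizes (zero , sg) _ = inj₁ (size≡1⇒unit g (trans (sym (size-norm g)) sg))
      by-sizes (suc i , _) (zero , sh) = inj₂ (size≡1⇒unit h (trans (sym (size-norm h)) sh))
      by-sizes (suc i , sg) (suc j , sh) = ⊥-elim (f∤fact-top (subst (λ d → f ∣ fact (top d)) (sym d≡i+j)
        (distinctSmallFactors∣fact-top (factorisation⇒distinctSmallFactors nf hyp (norm g) (norm h)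
          (norm-normal g) (norm-normal h) gh≈f sg sh (s≤s z≤n) (s≤s z≤n)))))
        where
        d≡i+j : d ≡ suc i ℕ.+ suc j
        d≡i+j = suc-injective (trans (sym sf)
                  (trans (sym (size-resp gh≈f)) (size-⊗ (norm g) (norm h) sg sh)))

proposition3p3 : (k : ℕ) (𝔽 : FiniteField k) → let open Poly 𝔽 in
    (f : Pol) → Normal f → 1 ≤ deg f →
    (3 ≤ q ⊎ (∀ b c → f ≢ (b ∷ []) ⊗ ((c ∷ 1F ∷ []) ⊗ (c ∷ 1F ∷ [])))) →
    Irreducible f ⇔ IsS f (tpow (deg f))
proposition3p3 k 𝔽 f f-normal 1≤deg hyp =
  mk⇔ (irreducible⇒IsS f-normal size-f) (IsS⇒irreducible f-normal size-f 1≤deg hyp)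
  where
  open PolynomialsOver 𝔽
  size-f = size≡1+deg f-normal 1≤deg
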